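{- Let $n\in\mathbb N$ and let $M,M'$ be in-models. (1) If $w,w'$ are worlds of $M,M'$ with $M,w\sim_n M',w'$, then $M,w\equiv_n M',w'$. (2) If $s,s'$ are states of $M,M'$ with $M,s\sim_n M',s'$, then $M,s\equiv_n M',s'$.
   Context: Fix a set $\mathcal P$ of atoms (not necessarily finite). Formulas of $\mathcal L_{\Rrightarrow}$: $\varphi ::= p \mid \bot \mid (\varphi\wedge\varphi)\mid(\varphi\to\varphi)\mid(\varphi\veebar\varphi)\mid(\varphi\Rrightarrow\varphi)$, $p\in\mathcal P$, with $\veebar$ inquisitive disjunction. Modal depth: $\mathrm{md}(p)=\mathrm{md}(\bot)=0$; $\mathrm{md}(\varphi\circ\psi)=\max(\mathrm{md}\varphi,\mathrm{md}\psi)$ for $\circ\in\{\wedge,\veebar,\to\}$; $\mathrm{md}(\varphi\Rrightarrow\psi)=\max(\mathrm{md}\varphi,\mathrm{md}\psi)+1$. An in-model is $M=\langle W,\Sigma,V\rangle$ with $W$ nonempty, $\Sigma(w)$ a set of nonempty subsets of $W$, $V:W\times\mathcal P\to\{0,1\}$. Support at $s\subseteq W$: $M,s\models p$ iff $V(w,p)=1$ for all $w\in s$; $M,s\models\bot$ iff $s=\emptyset$; $\wedge$ conjunctively; $M,s\models\varphi\veebar\psi$ iff $M,s\models\varphi$ or $M,s\models\psi$; $M,s\models\varphi\to\psi$ iff for all $t\subseteq s$, $M,t\models\varphi$ implies $M,t\models\psi$; $M,s\models\varphi\Rrightarrow\psi$ iff for all $w\in s$, $t\in\Sigma(w)$,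 $M,t\models\varphi$ implies $M,t\models\psi$. Truth: $M,w\models\varphi$ iff $M,\{w\}\models\varphi$. $M,w\equiv_nM',w'$: same true formulas of modal depth $\le n$; $M,s\equiv_nM',s'$: same supported formulas of modal depth $\le n$. Egli-Milner lifting of $R\subseteq X\times Y$: $A\overline RB$ iff every $a\in A$ has $b\in B$ with $aRb$ and every $b\in B$ has $a\in A$ with $aRb$. An $n$-bisimulation between $M=\langle W,\Sigma,V\rangle$, $M'=\langle W',\Sigma',V'\rangle$ is a family $(Z_i)_{i\le n}$, $Z_i\subseteq W\times W'$, such that whenever $wZ_iw'$: $V(w,p)=V'(w',p)$ for all $p$; if $i>0$, every $s\in\Sigma(w)$ has $s'\in\Sigma'(w')$ with $s\overline{Z_{i-1}}s'$ and every $s'\in\Sigma'(w')$ has $s\in\Sigma(w)$ with $s\overline{Z_{i-1}}s'$. $M,w\sim_nM',w'$ iff some $n$-bisimulation has $wZ_nw'$; $M,s\sim_nM',s'$ iff some $n$-bisimulation has $s\overline{Z_n}s'$. -}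

module Defs where

open import Level using (0ℓ)
open import Data.Nat using (ℕ; zero; suc; _≤_; _⊔_)
open import Data.Bool using (Bool; true)
open import Data.Product using (Σ; ∃; ∃-syntax; _×_; _,_)
open import Data.Sum using (_⊎_)
open import Relation.Nullary using (¬_)
open import Relation.Binary.PropositionalEquality using (_≡_)
open import Function.Bundles using (_⇔_)

data Form (P : Set) : Set where
  atom : P → Form P
  ⊥f   : Form P
  _∧f_ : Form P → Form P → Form P
  _→f_ : Form P → Form P → Form P
  _⊻f_ : Form P → Form P → Form P
  _⇛f_ : Form P → Form P → Form P

md : {P : Set} → Form P → ℕ
md (atom p) = 0
md ⊥f = 0
md (φ ∧f ψ) = md φ ⊔ md ψ
md (φ →f ψ) = md φ ⊔ md ψ
md (φ ⊻f ψ) = md φ ⊔ md ψ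
md (φ ⇛f ψ) = suc (md φ ⊔ md ψ)

Subset : Set → Set₁
Subset W = W → Set

_⊆_ : {W : Set} → Subset W → Subset W → Set
s ⊆ t = ∀ w → s w → t w

⟦_⟧ : {W : Set} → W → Subset W
⟦ w ⟧ = λ v → v ≡ w

record InModel (P : Set) : Set₁ where
  field
    W        : Set
    inhabited : W
    Σm       : W → Subset W → Set
    Σm-nonempty : ∀ w s → Σm w s → ∃[ v ] s v
    V        : W → P → Bool

open InModel public

_,_⊨_ : {P : Set} (M : InModel P) → Subset (W M) → Form P → Set₁
M , s ⊨ atom p = Level.Lift _ (∀ w → s w → V M w p ≡ true)
M , s ⊨ ⊥f = Level.Lift _ (∀ w → ¬ s w)
M , s ⊨ (φ ∧f ψ) = (M , s ⊨ φ) × (M , s ⊨ ψ)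
M , s ⊨ (φ →f ψ) = ∀ (t : Subset (W M)) → t ⊆ s → M , t ⊨ φ → M , t ⊨ ψ
M , s ⊨ (φ ⊻f ψ) = (M , s ⊨ φ) ⊎ (M , s ⊨ ψ)
M , s ⊨ (φ ⇛f ψ) = ∀ w → s w → ∀ (t : Subset (W M)) → Σm M w t → M , t ⊨ φ → M , t ⊨ ψ

_,_⊨w_ : {P : Set} (M : InModel P) → W M → Form P → Set₁
M , w ⊨w φ = M , ⟦ w ⟧ ⊨ φ

WEquiv : {P : Set} → ℕ → (M : InModel P) → W M → (M' : InModel P) → W M' → Set₁
WEquiv n M w M' w' = ∀ φ → md φ ≤ n → (M , w ⊨w φ) ⇔ (M' , w' ⊨w φ)

SEquiv : {P : Set} → ℕ → (M : InModel P) → Subset (W M) → (M' : InModel P) → Subset (W M') → Set₁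
SEquiv n M s M' s' = ∀ φ → md φ ≤ n → (M , s ⊨ φ) ⇔ (M' , s' ⊨ φ)

EM : {X Y : Set} → (X → Y → Set) → Subset X → Subset Y → Set
EM R A B = (∀ a → A a → ∃[ b ] (B b × R a b)) × (∀ b → B b → ∃[ a ] (A a × R a b))

-- n-bisimulation: a family (Z_i)_{i ≤ n}; we use Z : ℕ → ..., with the
-- clauses imposed only for indices i ≤ n (values above n are irrelevant).
record IsBisim {P : Set} (n : ℕ) (M M' : InModel P) (Z : ℕ → W M → W M' → Set) : Set₁ where
  field
    atoms : ∀ i → i ≤ n → ∀ w w' → Z i w w' → ∀ p → V M w p ≡ V M' w' p
    forth : ∀ i → suc i ≤ n → ∀ w w' → Z (suc i) w w' →
              ∀ s → Σm M w s → ∃[ s' ] (Σm M' w' s' × EM (Z i) s s')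
    back  : ∀ i → suc i ≤ n → ∀ w w' → Z (suc i) w w' →
              ∀ s' → Σm M' w' s' → ∃[ s ] (Σm M w s × EM (Z i) s s')

WBisim : {P : Set} → ℕ → (M : InModel P) → W M → (M' : InModel P) → W M' → Set₁
WBisim n M w M' w' = ∃[ Z ] (IsBisim n M M' Z × Z n w w')

SBisim : {P : Set} → ℕ → (M : InModel P) → Subset (W M) → (M' : InModel P) → Subset (W M') → Set₁
SBisim n M s M' s' = ∃[ Z ] (IsBisim n M M' Z × EM (Z n) s s')

{-# OPTIONS --safe #-}
module Submission where

open import Defs
open import Level using (lift)
open import Data.Nat using (ℕ; suc; _≤_; s≤s)
open import Data.Nat.Properties using (≤-trans; ≤-refl; n≤1+n; m⊔n≤o⇒m≤o; m⊔n≤o⇒n≤o)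
open import Data.Product using (_×_; _,_; proj₁; proj₂; ∃-syntax)
open import Data.Sum using (inj₁; inj₂)
open import Function.Base using (flip)
open import Function.Bundles using (mk⇔)
open import Relation.Binary.PropositionalEquality using (refl; sym; trans)

-- Support is transferred from s to s' along an Egli-Milner related pair by
-- induction on the formula.  The antecedents of → and ⇛ must be transferred
-- backwards, which is the same statement for the converse bisimulation.  For
-- → a substate t' of s' is matched by the points of s related to t'; for ⇛
-- the back clause supplies the matching neighbourhood.  Worlds are the
-- special case of singleton states.

module _ {X Y : Set} {R : X → Y → Set} where

  EM-converse : {s : Subset X} {s' : Subset Y} → EM R s s' → EM (flip R) s' s
  EM-converse (forth , back) = back , forth

  EM-restrictʳ : {s : Subset X} {s' t' : Subset Y} → EM R s s' → t' ⊆ s' →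
                 ∃[ t ] (t ⊆ s × EM R t t')
  EM-restrictʳ {s} {t' = t'} (_ , back) t'⊆s' = t , (λ _ → proj₁) , forth-t , back-t
    where
    t : Subset X
    t a = s a × ∃[ b ] (t' b × R a b)

    forth-t : ∀ a → t a → ∃[ b ] (t' b × R a b)
    forth-t _ = proj₂

    back-t : ∀ b → t' b → ∃[ a ] (t a × R a b)
    back-t b tb with back b (t'⊆s' b tb)
    ... | a , sa , aRb = a , (sa , b , tb , aRb) , aRb

  EM-singleton : {x : X} {y : Y} → R x y → EM R ⟦ x ⟧ ⟦ y ⟧
  EM-singleton {x} {y} xRy = (λ { _ refl → y , refl , xRy }) , (λ { _ refl → x , refl , xRy })

module _ {P : Set} {M M' : InModel P} {Z : ℕ → W M → W M' → Set} where

  IsBisim-converse : ∀ {n} → IsBisim n M M' Z → IsBisim n M' M (λ i → flip (Z i))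
  IsBisim-converse B = record
    { atoms = λ i i≤n w' w z p → sym (atoms i i≤n w w' z p)
    ; forth = λ i i<n w' w z s' σ → let s , σs , em = back i i<n w w' z s' σ in s , σs , EM-converse em
    ; back  = λ i i<n w' w z s σ → let s' , σs' , em = forth i i<n w w' z s σ in s' , σs' , EM-converse em
    }
    where open IsBisim B

  IsBisim-mono : ∀ {m n} → m ≤ n → IsBisim n M M' Z → IsBisim m M M' Z
  IsBisim-mono m≤n B = record
    { atoms = λ i i≤m → atoms i (≤-trans i≤m m≤n)
    ; forth = λ i i<m → forth i (≤-trans i<m m≤n)
    ; back  = λ i i<m → back i (≤-trans i<m m≤n)
    }
    where open IsBisim B

⊨-resp-bisim : ∀ {P} {M M' : InModel P} {Z : ℕ → W M → W M' → Set} {i} →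
               IsBisim i M M' Z → ∀ φ → md φ ≤ i →
               ∀ {s s'} → EM (Z i) s s' → M , s ⊨ φ → M' , s' ⊨ φ
⊨-resp-bisim {i = i} B (atom p) _ (_ , back) (lift h) = lift λ b sb →
  let a , sa , aZb = back b sb in trans (sym (IsBisim.atoms B i ≤-refl a b aZb p)) (h a sa)
⊨-resp-bisim B ⊥f _ (_ , back) (lift h) = lift λ b sb →
  let a , sa , _ = back b sb in h a sa
⊨-resp-bisim B (φ ∧f ψ) md≤ em (hφ , hψ) =
  ⊨-resp-bisim B φ (m⊔n≤o⇒m≤o (md φ) (md ψ) md≤) em hφ ,
  ⊨-resp-bisim B ψ (m⊔n≤o⇒n≤o (md φ) (md ψ) md≤) em hψ
⊨-resp-bisim B (φ ⊻f ψ) md≤ em (inj₁ hφ) = inj₁ (⊨-resp-bisim B φ (m⊔n≤o⇒m≤o (md φ) (md ψ) md≤) em hφ)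
⊨-resp-bisim B (φ ⊻f ψ) md≤ em (inj₂ hψ) = inj₂ (⊨-resp-bisim B ψ (m⊔n≤o⇒n≤o (md φ) (md ψ) md≤) em hψ)
⊨-resp-bisim B (φ →f ψ) md≤ em h t' t'⊆s' hφ' =
  let t , t⊆s , emt = EM-restrictʳ em t'⊆s'
      hφ = ⊨-resp-bisim (IsBisim-converse B) φ (m⊔n≤o⇒m≤o (md φ) (md ψ) md≤) (EM-converse emt) hφ'
  in ⊨-resp-bisim B ψ (m⊔n≤o⇒n≤o (md φ) (md ψ) md≤) emt (h t t⊆s hφ)
⊨-resp-bisim {i = suc j} B (φ ⇛f ψ) (s≤s md≤) (_ , back) h w' sw' t' σ' hφ' =
  let w , sw , wZw' = back w' sw'
      t , σ , emt = IsBisim.back B j ≤-refl w w' wZw' t' σ'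
      Bj = IsBisim-mono (n≤1+n j) B
      hφ = ⊨-resp-bisim (IsBisim-converse Bj) φ (m⊔n≤o⇒m≤o (md φ) (md ψ) md≤) (EM-converse emt) hφ'
  in ⊨-resp-bisim Bj ψ (m⊔n≤o⇒n≤o (md φ) (md ψ) md≤) emt (h w sw t σ hφ)

SBisim⇒SEquiv : ∀ {P} n (M M' : InModel P) (s : Subset (W M)) (s' : Subset (W M')) →
                SBisim n M s M' s' → SEquiv n M s M' s'
SBisim⇒SEquiv n M M' s s' (Z , B , em) φ md≤ =
  mk⇔ (⊨-resp-bisim B φ md≤ em) (⊨-resp-bisim (IsBisim-converse B) φ md≤ (EM-converse em))

WBisim⇒WEquiv : ∀ {P} n (M M' : InModel P) (w : W M) (w' : W M') →
                WBisim n M w M' w' → WEquiv n M w M' w'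
WBisim⇒WEquiv n M M' w w' (Z , B , wZw') = SBisim⇒SEquiv n M M' ⟦ w ⟧ ⟦ w' ⟧ (Z , B , EM-singleton wZw')

proposition5p6 : {P : Set} (n : ℕ) (M M' : InModel P) →
    (∀ (w : W M) (w' : W M') → WBisim n M w M' w' → WEquiv n M w M' w') ×
    (∀ (s : Subset (W M)) (s' : Subset (W M')) → SBisim n M s M' s' → SEquiv n M s M' s')
proposition5p6 n M M' = WBisim⇒WEquiv n M M' , SBisim⇒SEquiv n M M'
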